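{- Let $\mathcal{Y}$ be the affine Yangian of $\mathfrak{gl}(1)$ and let $\diamondsuit=\{\mathrm{ad}_{e_1}^{n-1}e_0 : n=1,2,3,\dots\}\subset\mathcal{Y}$. If $A\in\mathcal{Y}$ commutes with every element of $\diamondsuit$, i.e. $[A,\mathrm{ad}_{e_1}^{n-1}e_0]=0$ for all $n\ge 1$, then $[e_1,A]$ also commutes with every element of $\diamondsuit$.
   Context: Let $h_1,h_2,h_3\in\mathbb{C}$ with $h_1+h_2+h_3=0$, and put $\sigma_2=h_1h_2+h_1h_3+h_2h_3$, $\sigma_3=h_1h_2h_3$. The affine Yangian $\mathcal{Y}$ of $\mathfrak{gl}(1)$ is the associative algebra with generators $e_j,f_j,\psi_j$ ($j=0,1,2,\dots$), with $\psi_0=1$, subject to: $[\psi_j,\psi_k]=0$; $[e_j,f_k]=\psi_{j+k}$; $[e_{j+3},e_k]-3[e_{j+2},e_{k+1}]+3[e_{j+1},e_{k+2}]-[e_j,e_{k+3}]+\sigma_2[e_{j+1},e_k]-\sigma_2[e_j,e_{k+1}]-\sigma_3\{e_j,e_k\}=0$; the same relation with $e$ replaced by $f$ and $-\sigma_3$ replaced by $+\sigma_3$; the relation obtained from the $e$-relation by replacing the first entry of each bracket by $\psi$ (i.e. $[\psi_{j+3},e_k]-3[\psi_{j+2},e_{k+1}]+\dots-\sigma_3\{\psi_j,e_k\}=0$) and likewise for $f$ with $+\sigma_3$; $[\psi_0,e_j]=[\psi_1,e_j]=0$, $[\psi_2,e_j]=2e_j$, $[\psi_0,f_j]=[\psi_1,f_j]=0$,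 $[\psi_2,f_j]=-2f_j$; and $\mathrm{Sym}_{(j_1,j_2,j_3)}[e_{j_1},[e_{j_2},e_{j_3+1}]]=0$, $\mathrm{Sym}_{(j_1,j_2,j_3)}[f_{j_1},[f_{j_2},f_{j_3+1}]]=0$, where Sym is the sum over the 6 permutations of $(j_1,j_2,j_3)$. Here $[x,y]=xy-yx$, $\{x,y\}=xy+yx$, and $\mathrm{ad}_x(y)=[x,y]$. -}

module Defs where

open import Level using (_⊔_)
open import Data.Nat using (ℕ; zero; suc; NonZero) renaming (_+_ to _+ℕ_)
open import Algebra.Bundles using (CommutativeRing)

-- The affine Yangian of gl(1), presented by generators and relations as an
-- associative unital algebra over a commutative ring K (standing in for ℂ).
-- Elements are formal expressions (Tm) and equality in the algebra is the
-- smallest congruence (_≈Y_) containing the algebra axioms and the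
-- defining relations, i.e. Y is the setoid quotient Tm / _≈Y_.
module Yangian {c ℓ} (K : CommutativeRing c ℓ)
               (h₁ h₂ h₃ : CommutativeRing.Carrier K) where

  open CommutativeRing K using () renaming
    (Carrier to S; _≈_ to _≈K_; _+_ to _+K_; _*_ to _*K_; -_ to -K_;
     0# to 0K; 1# to 1K)

  σ₂ : S
  σ₂ = (h₁ *K h₂ +K h₁ *K h₃) +K h₂ *K h₃

  σ₃ : S
  σ₃ = (h₁ *K h₂) *K h₃

  infixl 6 _⊕_
  infixl 7 _⊗_
  data Tm : Set c where
    e f ψ : ℕ → Tm
    sc    : S → Tm              -- scalar k·1
    _⊕_   : Tm → Tm → Tm
    _⊗_   : Tm → Tm → Tm
    neg   : Tm → Tm

  𝟘 𝟙 : Tm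
  𝟘 = sc 0K
  𝟙 = sc 1K

  _⊖_ : Tm → Tm → Tm
  x ⊖ y = x ⊕ neg y
  infixl 6 _⊖_

  [_,_] : Tm → Tm → Tm
  [ x , y ] = x ⊗ y ⊖ y ⊗ x

  ⟦_,_⟧₊ : Tm → Tm → Tm
  ⟦ x , y ⟧₊ = x ⊗ y ⊕ y ⊗ x

  two three : S
  two = 1K +K 1K
  three = two +K 1K

  cubic : S → (ℕ → Tm) → (ℕ → Tm) → ℕ → ℕ → Tm
  cubic s a b j k =
      [ a (j +ℕ 3) , b k ]
    ⊖ sc three ⊗ [ a (j +ℕ 2) , b (k +ℕ 1) ]
    ⊕ sc three ⊗ [ a (j +ℕ 1) , b (k +ℕ 2) ]
    ⊖ [ a j , b (k +ℕ 3) ]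
    ⊕ sc σ₂ ⊗ [ a (j +ℕ 1) , b k ]
    ⊖ sc σ₂ ⊗ [ a j , b (k +ℕ 1) ]
    ⊕ sc s ⊗ ⟦ a j , b k ⟧₊

  serre : (ℕ → Tm) → ℕ → ℕ → ℕ → Tm
  serre x j₁ j₂ j₃ =
      [ x j₁ , [ x j₂ , x (j₃ +ℕ 1) ] ]
    ⊕ [ x j₁ , [ x j₃ , x (j₂ +ℕ 1) ] ]
    ⊕ [ x j₂ , [ x j₁ , x (j₃ +ℕ 1) ] ]
    ⊕ [ x j₂ , [ x j₃ , x (j₁ +ℕ 1) ] ]
    ⊕ [ x j₃ , [ x j₁ , x (j₂ +ℕ 1) ] ]
    ⊕ [ x j₃ , [ x j₂ , x (j₁ +ℕ 1) ] ]

  infix 4 _≈Y_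
  data _≈Y_ : Tm → Tm → Set (c ⊔ ℓ) where
    Y-refl  : ∀ {x} → x ≈Y x
    Y-sym   : ∀ {x y} → x ≈Y y → y ≈Y x
    Y-trans : ∀ {x y z} → x ≈Y y → y ≈Y z → x ≈Y z
    ⊕-cong : ∀ {x x' y y'} → x ≈Y x' → y ≈Y y' → x ⊕ y ≈Y x' ⊕ y'
    ⊗-cong : ∀ {x x' y y'} → x ≈Y x' → y ≈Y y' → x ⊗ y ≈Y x' ⊗ y'
    neg-cong : ∀ {x y} → x ≈Y y → neg x ≈Y neg y
    sc-cong : ∀ {k l} → k ≈K l → sc k ≈Y sc l
    ⊕-assoc : ∀ x y z → (x ⊕ y) ⊕ z ≈Y x ⊕ (y ⊕ z)
    ⊕-comm  : ∀ x y → x ⊕ y ≈Y y ⊕ x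
    ⊕-idˡ   : ∀ x → 𝟘 ⊕ x ≈Y x
    neg-invˡ : ∀ x → neg x ⊕ x ≈Y 𝟘
    ⊗-assoc : ∀ x y z → (x ⊗ y) ⊗ z ≈Y x ⊗ (y ⊗ z)
    ⊗-idˡ   : ∀ x → 𝟙 ⊗ x ≈Y x
    ⊗-idʳ   : ∀ x → x ⊗ 𝟙 ≈Y x
    distribˡ : ∀ x y z → x ⊗ (y ⊕ z) ≈Y x ⊗ y ⊕ x ⊗ z
    distribʳ : ∀ x y z → (y ⊕ z) ⊗ x ≈Y y ⊗ x ⊕ z ⊗ x
    sc-+ : ∀ k l → sc (k +K l) ≈Y sc k ⊕ sc l
    sc-* : ∀ k l → sc (k *K l) ≈Y sc k ⊗ sc l
    sc-central : ∀ k x → sc k ⊗ x ≈Y x ⊗ sc k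
    ψ₀≡1 : ψ 0 ≈Y 𝟙
    ψψ : ∀ j k → [ ψ j , ψ k ] ≈Y 𝟘
    ef : ∀ j k → [ e j , f k ] ≈Y ψ (j +ℕ k)
    ee : ∀ j k → cubic (-K σ₃) e e j k ≈Y 𝟘
    ff : ∀ j k → cubic σ₃ f f j k ≈Y 𝟘
    ψe : ∀ j k → cubic (-K σ₃) ψ e j k ≈Y 𝟘
    ψf : ∀ j k → cubic σ₃ ψ f j k ≈Y 𝟘
    ψ₀e : ∀ j → [ ψ 0 , e j ] ≈Y 𝟘
    ψ₁e : ∀ j → [ ψ 1 , e j ] ≈Y 𝟘
    ψ₂e : ∀ j → [ ψ 2 , e j ] ≈Y sc two ⊗ e j
    ψ₀f : ∀ j → [ ψ 0 , f j ] ≈Y 𝟘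
    ψ₁f : ∀ j → [ ψ 1 , f j ] ≈Y 𝟘
    ψ₂f : ∀ j → [ ψ 2 , f j ] ≈Y neg (sc two ⊗ f j)
    serre-e : ∀ j₁ j₂ j₃ → serre e j₁ j₂ j₃ ≈Y 𝟘
    serre-f : ∀ j₁ j₂ j₃ → serre f j₁ j₂ j₃ ≈Y 𝟘

  adPow : Tm → ℕ → Tm → Tm
  adPow x zero    y = y
  adPow x (suc n) y = [ x , adPow x n y ]

  ♢ : (n : ℕ) → .{{_ : NonZero n}} → Tm
  ♢ (suc n) = adPow (e 1) n (e 0)

{-# OPTIONS --safe #-}
module Submission where

open import Defs
open import Data.Nat using (suc)
open import Algebra.Bundles using (CommutativeRing; Ring)
open import Data.Product using (_,_)
open import Level using (_⊔_)

-- ad_a is a derivation of the commutator bracket, so if b commutes with c and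
-- with [a, c], then [a, b] commutes with c. Since ad_{e₁} maps ♢ n to ♢ (n + 1),
-- the hypothesis on A supplies both facts; only the associative-algebra axioms
-- of the Yangian are used, none of its defining relations.

module Commutator {r₁ r₂} (R : Ring r₁ r₂) where
  open Ring R
  open import Algebra.Properties.Ring R using (x[y-z]≈xy-xz; [y-z]x≈yx-zx)
  open import Algebra.Properties.AbelianGroup +-abelianGroup using (⁻¹-∙-comm)
  open import Algebra.Properties.CommutativeSemigroup +-commutativeSemigroup using (interchange)
  open import Relation.Binary.Reasoning.Setoid setoid

  ⁅_,_⁆ : Carrier → Carrier → Carrier
  ⁅ x , y ⁆ = x * y - y * x

  Commute : Carrier → Carrier → Set r₂
  Commute x y = ⁅ x , y ⁆ ≈ 0#

  ⁅⁆-congˡ : ∀ a {x y} → x ≈ y → ⁅ a , x ⁆ ≈ ⁅ a , y ⁆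
  ⁅⁆-congˡ a x≈y = +-cong (*-congˡ x≈y) (-‿cong (*-congʳ x≈y))

  ⁅⁆-zeroʳ : ∀ a → ⁅ a , 0# ⁆ ≈ 0#
  ⁅⁆-zeroʳ a = begin
    a * 0# - 0# * a  ≈⟨ +-cong (zeroʳ a) (-‿cong (zeroˡ a)) ⟩
    0# - 0#          ≈⟨ -‿inverseʳ 0# ⟩
    0#               ∎

  [p+q]-[r+s]≈[p-r]+[q-s] : ∀ p q r s → (p + q) - (r + s) ≈ (p - r) + (q - s)
  [p+q]-[r+s]≈[p-r]+[q-s] p q r s = begin
    (p + q) - (r + s)      ≈⟨ +-congˡ (⁻¹-∙-comm r s) ⟨
    (p + q) + (- r + - s)  ≈⟨ interchange p q (- r) (- s) ⟩
    (p - r) + (q - s)      ∎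

  [p-q]-[r-s]≈[p-r]-[q-s] : ∀ p q r s → (p - q) - (r - s) ≈ (p - r) - (q - s)
  [p-q]-[r-s]≈[p-r]-[q-s] p q r s = begin
    (p - q) - (r - s)        ≈⟨ [p+q]-[r+s]≈[p-r]+[q-s] p (- q) r (- s) ⟩
    (p - r) + (- q - - s)    ≈⟨ +-congˡ (⁻¹-∙-comm q (- s)) ⟩
    (p - r) - (q - s)        ∎

  [p-q]+[q-r]≈p-r : ∀ p q r → (p - q) + (q - r) ≈ p - r
  [p-q]+[q-r]≈p-r p q r = begin
    (p - q) + (q - r)    ≈⟨ +-assoc p (- q) (q - r) ⟩
    p + (- q + (q - r))  ≈⟨ +-congˡ (+-assoc (- q) q (- r)) ⟨
    p + ((- q + q) - r)  ≈⟨ +-congˡ (+-congʳ (-‿inverseˡ q)) ⟩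
    p + (0# - r)         ≈⟨ +-congˡ (+-identityˡ (- r)) ⟩
    p - r                ∎

  ⁅a,u-v⁆≈⁅a,u⁆-⁅a,v⁆ : ∀ a u v → ⁅ a , u - v ⁆ ≈ ⁅ a , u ⁆ - ⁅ a , v ⁆
  ⁅a,u-v⁆≈⁅a,u⁆-⁅a,v⁆ a u v = begin
    a * (u - v) - (u - v) * a          ≈⟨ +-cong (x[y-z]≈xy-xz a u v) (-‿cong ([y-z]x≈yx-zx a u v)) ⟩
    (a * u - a * v) - (u * a - v * a)  ≈⟨ [p-q]-[r-s]≈[p-r]-[q-s] (a * u) (a * v) (u * a) (v * a) ⟩
    ⁅ a , u ⁆ - ⁅ a , v ⁆              ∎

  ⁅⁆-leibniz-* : ∀ a b c → ⁅ a , b * c ⁆ ≈ ⁅ a , b ⁆ * c + b * ⁅ a , c ⁆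
  ⁅⁆-leibniz-* a b c = begin
    a * (b * c) - (b * c) * a                          ≈⟨ +-congˡ (-‿cong (*-assoc b c a)) ⟩
    a * (b * c) - b * (c * a)                          ≈⟨ [p-q]+[q-r]≈p-r _ (b * (a * c)) _ ⟨
    (a * (b * c) - b * (a * c)) + (b * (a * c) - b * (c * a))
      ≈⟨ +-cong (+-cong (*-assoc a b c) (-‿cong (*-assoc b a c))) (x[y-z]≈xy-xz b (a * c) (c * a)) ⟨
    ((a * b) * c - (b * a) * c) + b * ⁅ a , c ⁆        ≈⟨ +-congʳ ([y-z]x≈yx-zx c (a * b) (b * a)) ⟨
    ⁅ a , b ⁆ * c + b * ⁅ a , c ⁆                      ∎

  ⁅⁆-leibniz-⁅⁆ : ∀ a b c → ⁅ a , ⁅ b , c ⁆ ⁆ ≈ ⁅ ⁅ a , b ⁆ , c ⁆ + ⁅ b , ⁅ a , c ⁆ ⁆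
  ⁅⁆-leibniz-⁅⁆ a b c = begin
    ⁅ a , b * c - c * b ⁆                                ≈⟨ ⁅a,u-v⁆≈⁅a,u⁆-⁅a,v⁆ a (b * c) (c * b) ⟩
    ⁅ a , b * c ⁆ - ⁅ a , c * b ⁆                        ≈⟨ +-cong (⁅⁆-leibniz-* a b c) (-‿cong (⁅⁆-leibniz-* a c b)) ⟩
    (⁅ a , b ⁆ * c + b * ⁅ a , c ⁆) - (⁅ a , c ⁆ * b + c * ⁅ a , b ⁆)
      ≈⟨ +-congˡ (-‿cong (+-comm _ _)) ⟩
    (⁅ a , b ⁆ * c + b * ⁅ a , c ⁆) - (c * ⁅ a , b ⁆ + ⁅ a , c ⁆ * b)
      ≈⟨ [p+q]-[r+s]≈[p-r]+[q-s] _ _ _ _ ⟩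
    ⁅ ⁅ a , b ⁆ , c ⁆ + ⁅ b , ⁅ a , c ⁆ ⁆                ∎

  commute-⁅⁆ : ∀ {a b c} → Commute b c → Commute b ⁅ a , c ⁆ → Commute ⁅ a , b ⁆ c
  commute-⁅⁆ {a} {b} {c} b∼c b∼ac = begin
    ⁅ ⁅ a , b ⁆ , c ⁆                        ≈⟨ +-identityʳ _ ⟨
    ⁅ ⁅ a , b ⁆ , c ⁆ + 0#                   ≈⟨ +-congˡ b∼ac ⟨
    ⁅ ⁅ a , b ⁆ , c ⁆ + ⁅ b , ⁅ a , c ⁆ ⁆    ≈⟨ ⁅⁆-leibniz-⁅⁆ a b c ⟨
    ⁅ a , ⁅ b , c ⁆ ⁆                        ≈⟨ ⁅⁆-congˡ a b∼c ⟩
    ⁅ a , 0# ⁆                               ≈⟨ ⁅⁆-zeroʳ a ⟩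
    0#                                       ∎

module YangianRing {c ℓ} (K : CommutativeRing c ℓ) (h₁ h₂ h₃ : CommutativeRing.Carrier K) where
  open Yangian K h₁ h₂ h₃

  ring : Ring c (c ⊔ ℓ)
  ring = record
    { Carrier = Tm ; _≈_ = _≈Y_ ; _+_ = _⊕_ ; _*_ = _⊗_ ; -_ = neg ; 0# = 𝟘 ; 1# = 𝟙
    ; isRing = record
      { +-isAbelianGroup = record
        { isGroup = record
          { isMonoid = record
            { isSemigroup = record
              { isMagma = record
                { isEquivalence = record { refl = Y-refl ; sym = Y-sym ; trans = Y-trans }
                ; ∙-cong = ⊕-cong }
              ; assoc = ⊕-assoc }
            ; identity = ⊕-idˡ , λ x → Y-trans (⊕-comm x 𝟘) (⊕-idˡ x) }
          ; inverse = neg-invˡ , λ x → Y-trans (⊕-comm x (neg x)) (neg-invˡ x)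
          ; ⁻¹-cong = neg-cong }
        ; comm = ⊕-comm }
      ; *-cong = ⊗-cong
      ; *-assoc = ⊗-assoc
      ; *-identity = ⊗-idˡ , ⊗-idʳ
      ; distrib = distribˡ , distribʳ
      }
    }

mainTheorem1 : ∀ {c ℓ} (K : CommutativeRing c ℓ)
               (h₁ h₂ h₃ : CommutativeRing.Carrier K) →
               CommutativeRing._≈_ K (CommutativeRing._+_ K (CommutativeRing._+_ K h₁ h₂) h₃) (CommutativeRing.0# K) →
               let open Yangian K h₁ h₂ h₃ in
               (A : Tm) →
               (∀ n → [ A , ♢ (suc n) ] ≈Y 𝟘) →
               ∀ n → [ [ e 1 , A ] , ♢ (suc n) ] ≈Y 𝟘
mainTheorem1 K h₁ h₂ h₃ _ A A∼♢ n = commute-⁅⁆ (A∼♢ n) (A∼♢ (suc n))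
  where open Commutator (YangianRing.ring K h₁ h₂ h₃)
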